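{- Let $\#$ be a parametrized monad on a category $\mathbf{C}$ with finite coproducts. Suppose that $\varphi_Y:FY\#FY\to FY$ with iteration operator $(-)^\dagger$, together with $\eta_Y:Y\to FY$, form a free complete Elgot $\#$-algebra on $Y$. Then for every morphism $e:X\to FY\#X$, $e^\dagger:X\to FY$ is the unique morphism $d:X\to FY$ satisfying $d=\varphi_Y\circ(\mathrm{id}_{FY}\#d)\circ e$.
   Context: A parametrized monad is a bifunctor $\#:\mathbf{C}\times\mathbf{C}\to\mathbf{C}$ such that each $(-)\#X$ is a monad with unit $u^X_A:A\to A\#X$ and multiplication $m^X_A:(A\#X)\#X\to A\#X$, and for each $f:X\to Y$ the family $(\mathrm{id}_Z\#f)_Z$ is a monad morphism. A $\#$-algebra is $(A,a)$ with $a:A\#A\to A$, $a\circ u^A_A=\mathrm{id}$, $a\circ(a\#\mathrm{id})=a\circ m^A_A$. A complete Elgot $\#$-algebra is a $\#$-algebra $(A,a)$ with an operator sending each $e:X\to A\#X$ to $e^\dagger:X\to A$ such that: (solution) $e^\dagger=a\circ(\mathrm{id}_A\#e^\dagger)\circ e$; (functoriality) for $e:X\to A\#X$, $f:Y\to A\#Y$, $h:X\to Y$, if $f\circ h=(\mathrm{id}_A\#h)\circ e$ then $f^\dagger\circ h=e^\dagger$; (compositionality) for $f:Y\to A\#Y$ and $g:X\to Y\#X$, putting $f^\dagger\bullet g=(f^\dagger\#\mathrm{id}_X)\circ g$ and $f\blacksquare g=m^{Y+X}_A\circ(((\mathrm{id}_A\#\mathsf{inl})\circ f)\#\mathsf{inr})\circ[u^X_Y,g]$,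 one has $(f\blacksquare g)^\dagger\circ\mathsf{inr}=(f^\dagger\bullet g)^\dagger$. A morphism of complete Elgot $\#$-algebras $(A,a,\dagger)\to(B,b,\ddagger)$ is $f:A\to B$ with $((f\#\mathrm{id}_X)\circ e)^\ddagger=f\circ e^\dagger$ for all $e$. A free complete Elgot $\#$-algebra on $Y$ is a complete Elgot $\#$-algebra $FY$ with $\eta_Y:Y\to FY$ such that every morphism $g:Y\to B$ into a complete Elgot $\#$-algebra $B$ extends uniquely along $\eta_Y$ to a morphism of complete Elgot $\#$-algebras $FY\to B$. -}

module Defs where

open import Level using (Level; _⊔_) renaming (suc to lsuc)
open import Relation.Binary using (IsEquivalence)
open import Data.Product using (Σ; _×_; _,_)

record Category (o ℓ e : Level) : Set (lsuc (o ⊔ ℓ ⊔ e)) where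
  infixr 9 _∘_
  infix  4 _≈_
  field
    Obj       : Set o
    _⇒_       : Obj → Obj → Set ℓ
    _≈_       : ∀ {A B} → A ⇒ B → A ⇒ B → Set e
    id        : ∀ {A} → A ⇒ A
    _∘_       : ∀ {A B C} → B ⇒ C → A ⇒ B → A ⇒ C
    equiv     : ∀ {A B} → IsEquivalence (_≈_ {A} {B})
    ∘-resp-≈  : ∀ {A B C} {f h : B ⇒ C} {g i : A ⇒ B} → f ≈ h → g ≈ i → f ∘ g ≈ h ∘ i
    assoc     : ∀ {A B C D} {f : A ⇒ B} {g : B ⇒ C} {h : C ⇒ D} →
                (h ∘ g) ∘ f ≈ h ∘ (g ∘ f)
    identityˡ : ∀ {A B} {f : A ⇒ B} → id ∘ f ≈ f
    identityʳ : ∀ {A B} {f : A ⇒ B} → f ∘ id ≈ f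

record FiniteCoproducts {o ℓ e} (C : Category o ℓ e) : Set (o ⊔ ℓ ⊔ e) where
  open Category C
  infixr 6 _+_
  field
    ⊥         : Obj
    ¡         : ∀ {A} → ⊥ ⇒ A
    ¡-unique  : ∀ {A} (f : ⊥ ⇒ A) → ¡ ≈ f
    _+_       : Obj → Obj → Obj
    inl       : ∀ {A B} → A ⇒ (A + B)
    inr       : ∀ {A B} → B ⇒ (A + B)
    [_,_]     : ∀ {A B D} → A ⇒ D → B ⇒ D → (A + B) ⇒ D
    inject₁   : ∀ {A B D} {f : A ⇒ D} {g : B ⇒ D} → [ f , g ] ∘ inl ≈ f
    inject₂   : ∀ {A B D} {f : A ⇒ D} {g : B ⇒ D} → [ f , g ] ∘ inr ≈ g
    []-unique : ∀ {A B D} {f : A ⇒ D} {g : B ⇒ D} {h : (A + B) ⇒ D} →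
                h ∘ inl ≈ f → h ∘ inr ≈ g → [ f , g ] ≈ h

record ParametrizedMonad {o ℓ e} (C : Category o ℓ e) : Set (o ⊔ ℓ ⊔ e) where
  open Category C
  infixl 7 _#_ _#₁_
  field
    _#_          : Obj → Obj → Obj
    _#₁_         : ∀ {A B X Y} → A ⇒ B → X ⇒ Y → (A # X) ⇒ (B # Y)
    #-identity   : ∀ {A X} → (id {A} #₁ id {X}) ≈ id
    #-homomorphism : ∀ {A B D X Y Z} {f : A ⇒ B} {g : B ⇒ D} {h : X ⇒ Y} {k : Y ⇒ Z} →
                   ((g ∘ f) #₁ (k ∘ h)) ≈ (g #₁ k) ∘ (f #₁ h)
    #-resp-≈     : ∀ {A B X Y} {f g : A ⇒ B} {h k : X ⇒ Y} → f ≈ g → h ≈ k → (f #₁ h) ≈ (g #₁ k)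
    u            : ∀ X A → A ⇒ (A # X)
    m            : ∀ X A → ((A # X) # X) ⇒ (A # X)
    u-natural    : ∀ {X A B} (f : A ⇒ B) → (f #₁ id {X}) ∘ u X A ≈ u X B ∘ f
    m-natural    : ∀ {X A B} (f : A ⇒ B) →
                   (f #₁ id {X}) ∘ m X A ≈ m X B ∘ ((f #₁ id {X}) #₁ id {X})
    m-identityˡ  : ∀ {X A} → m X A ∘ u X (A # X) ≈ id
    m-identityʳ  : ∀ {X A} → m X A ∘ (u X A #₁ id {X}) ≈ id
    m-assoc      : ∀ {X A} → m X A ∘ m X (A # X) ≈ m X A ∘ (m X A #₁ id {X})
    -- for each f : X → Y, (id_Z # f)_Z is a monad morphism (its naturality in Z
    -- follows from bifunctoriality)
    mm-unit      : ∀ {X Y A} (f : X ⇒ Y) → (id {A} #₁ f) ∘ u X A ≈ u Y A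
    mm-mult      : ∀ {X Y A} (f : X ⇒ Y) →
                   (id {A} #₁ f) ∘ m X A ≈ m Y A ∘ ((id {A} #₁ f) #₁ f)

module _ {o ℓ e} {C : Category o ℓ e} (CP : FiniteCoproducts C) (P : ParametrizedMonad C) where
  open Category C
  open FiniteCoproducts CP
  open ParametrizedMonad P

  _•_ : ∀ {A X Y} → Y ⇒ A → X ⇒ (Y # X) → X ⇒ (A # X)
  _•_ {X = X} f† g = (f† #₁ id {X}) ∘ g

  _■_ : ∀ {A X Y} → Y ⇒ (A # Y) → X ⇒ (Y # X) → (Y + X) ⇒ (A # (Y + X))
  _■_ {A} {X} {Y} f g =
    m (Y + X) A ∘ (((id {A} #₁ inl) ∘ f) #₁ inr) ∘ [ u X Y , g ]

  record CompleteElgotAlgebra : Set (o ⊔ ℓ ⊔ e) where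
    field
      A         : Obj
      a         : (A # A) ⇒ A
      a-unit    : a ∘ u A A ≈ id
      a-mult    : a ∘ (a #₁ id {A}) ≈ a ∘ m A A
      _†        : ∀ {X} → X ⇒ (A # X) → X ⇒ A
      solution  : ∀ {X} (e : X ⇒ (A # X)) → e † ≈ a ∘ (id {A} #₁ (e †)) ∘ e
      functoriality : ∀ {X Y} (e : X ⇒ (A # X)) (f : Y ⇒ (A # Y)) (h : X ⇒ Y) →
                      f ∘ h ≈ (id {A} #₁ h) ∘ e → (f †) ∘ h ≈ e †
      compositionality : ∀ {X Y} (f : Y ⇒ (A # Y)) (g : X ⇒ (Y # X)) →
                      ((f ■ g) †) ∘ inr ≈ ((f †) • g) †

  open CompleteElgotAlgebra

  IsElgotMorphism : (𝔸 𝔹 : CompleteElgotAlgebra) → A 𝔸 ⇒ A 𝔹 → Set (o ⊔ ℓ ⊔ e)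
  IsElgotMorphism 𝔸 𝔹 f =
    ∀ {X} (e : X ⇒ (A 𝔸 # X)) → _†_ 𝔹 ((f #₁ id {X}) ∘ e) ≈ f ∘ _†_ 𝔸 e
    where _†_ : (𝔹 : CompleteElgotAlgebra) → ∀ {X} → X ⇒ (A 𝔹 # X) → X ⇒ A 𝔹
          _†_ 𝔹 = CompleteElgotAlgebra._† 𝔹

  IsFreeElgot : (Y : Obj) (FY : CompleteElgotAlgebra) (η : Y ⇒ A FY) → Set (o ⊔ ℓ ⊔ e)
  IsFreeElgot Y FY η =
    ∀ (𝔹 : CompleteElgotAlgebra) (g : Y ⇒ A 𝔹) →
      Σ (A FY ⇒ A 𝔹) λ h →
        (IsElgotMorphism FY 𝔹 h × h ∘ η ≈ g) ×
        (∀ (h' : A FY ⇒ A 𝔹) → IsElgotMorphism FY 𝔹 h' → h' ∘ η ≈ g → h' ≈ h)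

  UniqueSolution : (FY : CompleteElgotAlgebra) {X : Obj} (e′ : X ⇒ (A FY # X)) → Set (ℓ ⊔ e)
  UniqueSolution FY {X} e′ =
    (sol e′ ≈ φ ∘ (id {F} #₁ (sol e′)) ∘ e′)
    × (∀ (d : X ⇒ F) → d ≈ φ ∘ (id {F} #₁ d) ∘ e′ → d ≈ sol e′)
    where F = A FY
          φ = a FY
          sol = CompleteElgotAlgebra._† FY

module Submission where

-- The free algebra FY = (A, a, †) maps into the complete Elgot algebra carried by A # A
-- (structure m ∘ (id # a)) via the morphism c extending u ∘ η.  Since a is itself a
-- morphism of complete Elgot algebras, freeness gives a ∘ c = id, which in turn makes c a
-- homomorphism c ∘ a = m ∘ (c # id).  Compositionality for the systems c and e then shows
-- c † ∘ d = (c † • e) † for every solution d of e.  Taking d = e † makes c † an Elgot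
-- endomorphism fixing η, so c † = id by freeness, and any solution d equals (id • e) † = e †.

open import Data.Product using (_,_; proj₁; proj₂)
open import Relation.Binary using (IsEquivalence; Setoid)
import Relation.Binary.Reasoning.Setoid as SetoidReasoning
import Defs
open Defs hiding (_■_; _•_)

module ElgotAlgebraTheory {o ℓ ε} {C : Category o ℓ ε} (CP : FiniteCoproducts C) (P : ParametrizedMonad C) where
  open Category C
  open FiniteCoproducts CP
  open ParametrizedMonad P

  module Equiv {A B : Obj} = IsEquivalence (equiv {A} {B})

  hom-setoid : Obj → Obj → Setoid ℓ ε
  hom-setoid X Y = record { Carrier = X ⇒ Y ; _≈_ = _≈_ ; isEquivalence = equiv }

  module HomReasoning {X Y : Obj} = SetoidReasoning (hom-setoid X Y)
  open HomReasoning using (begin_; _∎; step-≈-⟩; step-≈-⟨)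

  _■_ : ∀ {A X Y} → Y ⇒ (A # Y) → X ⇒ (Y # X) → (Y + X) ⇒ (A # (Y + X))
  _■_ = Defs._■_ CP P

  infixr 10 _•_
  _•_ : ∀ {A X Y} → Y ⇒ A → X ⇒ (Y # X) → X ⇒ (A # X)
  _•_ = Defs._•_ CP P

  ∘-resp-≈ˡ : ∀ {A B D} {f h : B ⇒ D} {g : A ⇒ B} → f ≈ h → f ∘ g ≈ h ∘ g
  ∘-resp-≈ˡ p = ∘-resp-≈ p Equiv.refl

  ∘-resp-≈ʳ : ∀ {A B D} {f : B ⇒ D} {g h : A ⇒ B} → g ≈ h → f ∘ g ≈ f ∘ h
  ∘-resp-≈ʳ p = ∘-resp-≈ Equiv.refl p

  pullˡ : ∀ {A B D E} {f : A ⇒ B} {g : B ⇒ D} {h : D ⇒ E} {k : B ⇒ E} →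
          h ∘ g ≈ k → h ∘ (g ∘ f) ≈ k ∘ f
  pullˡ p = Equiv.trans (Equiv.sym assoc) (∘-resp-≈ˡ p)

  #-compose : ∀ {A B D X Y Z} {f : A ⇒ B} {g : B ⇒ D} {h : X ⇒ Y} {k : Y ⇒ Z} →
              (g #₁ k) ∘ (f #₁ h) ≈ ((g ∘ f) #₁ (k ∘ h))
  #-compose = Equiv.sym #-homomorphism

  id#-compose : ∀ {A X Y Z} {h : X ⇒ Y} {k : Y ⇒ Z} →
                (id {A} #₁ k) ∘ (id #₁ h) ≈ (id #₁ (k ∘ h))
  id#-compose = Equiv.trans #-compose (#-resp-≈ identityˡ Equiv.refl)

  #-identityˡ : ∀ {A B X} {f : B ⇒ (A # X)} → (id #₁ id) ∘ f ≈ f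
  #-identityˡ = Equiv.trans (∘-resp-≈ˡ #-identity) identityˡ

  coproduct-ext : ∀ {A B D} {h k : (A + B) ⇒ D} → h ∘ inl ≈ k ∘ inl → h ∘ inr ≈ k ∘ inr → h ≈ k
  coproduct-ext p q = Equiv.trans (Equiv.sym ([]-unique p q)) ([]-unique Equiv.refl Equiv.refl)

  #-commute : ∀ {A B X Y} {f : A ⇒ B} {h : X ⇒ Y} →
              (f #₁ id) ∘ (id #₁ h) ≈ (id #₁ h) ∘ (f #₁ id)
  #-commute = Equiv.trans #-compose
    (Equiv.trans (#-resp-≈ (Equiv.trans identityʳ (Equiv.sym identityˡ))
                           (Equiv.trans identityˡ (Equiv.sym identityʳ)))
                 #-homomorphism)

  •-∘ : ∀ {A B D X} {h : B ⇒ D} {k : A ⇒ B} {g : X ⇒ (A # X)} → h • (k • g) ≈ (h ∘ k) • g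
  •-∘ = Equiv.trans (Equiv.sym assoc)
          (∘-resp-≈ˡ (Equiv.trans #-compose (#-resp-≈ Equiv.refl identityˡ)))

  ■∘inl : ∀ {A X Y} (f : Y ⇒ (A # Y)) (g : X ⇒ (Y # X)) → (f ■ g) ∘ inl ≈ (id #₁ inl) ∘ f
  ■∘inl {A} {X} {Y} f g = begin
      (m (Y + X) A ∘ (((id #₁ inl) ∘ f) #₁ inr) ∘ [ u X Y , g ]) ∘ inl
    ≈⟨ Equiv.trans assoc (∘-resp-≈ʳ (Equiv.trans assoc (∘-resp-≈ʳ inject₁))) ⟩
      m (Y + X) A ∘ (((id #₁ inl) ∘ f) #₁ inr) ∘ u X Y
    ≈⟨ ∘-resp-≈ʳ (∘-resp-≈ˡ (Equiv.trans (#-resp-≈ (Equiv.sym identityʳ) (Equiv.sym identityˡ))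
                                          #-homomorphism)) ⟩
      m (Y + X) A ∘ ((((id #₁ inl) ∘ f) #₁ id) ∘ (id #₁ inr)) ∘ u X Y
    ≈⟨ ∘-resp-≈ʳ (Equiv.trans assoc (∘-resp-≈ʳ (mm-unit inr))) ⟩
      m (Y + X) A ∘ (((id #₁ inl) ∘ f) #₁ id) ∘ u (Y + X) Y
    ≈⟨ ∘-resp-≈ʳ (u-natural _) ⟩
      m (Y + X) A ∘ u (Y + X) (A # (Y + X)) ∘ (id #₁ inl) ∘ f
    ≈⟨ Equiv.trans (pullˡ m-identityˡ) identityˡ ⟩
      (id #₁ inl) ∘ f
    ∎

  id#∘■∘inr : ∀ {A X Y Z} (h : (Y + X) ⇒ Z) (f : Y ⇒ (A # Y)) (g : X ⇒ (Y # X)) →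
              (id #₁ h) ∘ (f ■ g) ∘ inr ≈ m Z A ∘ (((id #₁ (h ∘ inl)) ∘ f) #₁ (h ∘ inr)) ∘ g
  id#∘■∘inr {A} {X} {Y} {Z} h f g = begin
      (id #₁ h) ∘ (m (Y + X) A ∘ (((id #₁ inl) ∘ f) #₁ inr) ∘ [ u X Y , g ]) ∘ inr
    ≈⟨ ∘-resp-≈ʳ (Equiv.trans assoc (∘-resp-≈ʳ (Equiv.trans assoc (∘-resp-≈ʳ inject₂)))) ⟩
      (id #₁ h) ∘ m (Y + X) A ∘ (((id #₁ inl) ∘ f) #₁ inr) ∘ g
    ≈⟨ Equiv.trans (pullˡ (mm-mult h)) assoc ⟩
      m Z A ∘ ((id #₁ h) #₁ h) ∘ (((id #₁ inl) ∘ f) #₁ inr) ∘ g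
    ≈⟨ ∘-resp-≈ʳ (pullˡ #-compose) ⟩
      m Z A ∘ (((id #₁ h) ∘ (id #₁ inl) ∘ f) #₁ (h ∘ inr)) ∘ g
    ≈⟨ ∘-resp-≈ʳ (∘-resp-≈ˡ (#-resp-≈ (pullˡ id#-compose) Equiv.refl)) ⟩
      m Z A ∘ (((id #₁ (h ∘ inl)) ∘ f) #₁ (h ∘ inr)) ∘ g
    ∎

  •-■ : ∀ {A B X Y} (h : A ⇒ B) (f : Y ⇒ (A # Y)) (g : X ⇒ (Y # X)) → h • (f ■ g) ≈ (h • f) ■ g
  •-■ {A} {B} {X} {Y} h f g = begin
      (h #₁ id) ∘ m (Y + X) A ∘ (((id #₁ inl) ∘ f) #₁ inr) ∘ [ u X Y , g ]
    ≈⟨ Equiv.trans (pullˡ (m-natural h)) assoc ⟩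
      m (Y + X) B ∘ ((h #₁ id) #₁ id) ∘ (((id #₁ inl) ∘ f) #₁ inr) ∘ [ u X Y , g ]
    ≈⟨ ∘-resp-≈ʳ (pullˡ (Equiv.trans #-compose (#-resp-≈ swap identityˡ))) ⟩
      m (Y + X) B ∘ (((id #₁ inl) ∘ h • f) #₁ inr) ∘ [ u X Y , g ]
    ∎
    where
    swap : (h #₁ id) ∘ (id #₁ inl) ∘ f ≈ (id #₁ inl) ∘ (h #₁ id) ∘ f
    swap = Equiv.trans (Equiv.sym assoc) (Equiv.trans (∘-resp-≈ˡ #-commute) assoc)

  module ElgotAlgebraProperties (𝔸 : CompleteElgotAlgebra CP P) where
    open CompleteElgotAlgebra 𝔸

    †-resp-≈ : ∀ {X} {e f : X ⇒ (A # X)} → e ≈ f → e † ≈ f †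
    †-resp-≈ {e = e} {f} e≈f = Equiv.trans (Equiv.sym identityʳ) (functoriality f e id
      (Equiv.trans identityʳ (Equiv.trans e≈f (Equiv.sym #-identityˡ))))


    †∘-unit : ∀ {X Z} (e : X ⇒ (A # X)) (x : Z ⇒ X) (k : Z ⇒ A) →
              e ∘ x ≈ u X A ∘ k → e † ∘ x ≈ k
    †∘-unit {X} e x k e∘x = begin
        e † ∘ x
      ≈⟨ ∘-resp-≈ˡ (solution e) ⟩
        (a ∘ (id #₁ e †) ∘ e) ∘ x
      ≈⟨ Equiv.trans assoc (∘-resp-≈ʳ (Equiv.trans assoc (∘-resp-≈ʳ e∘x))) ⟩
        a ∘ (id #₁ e †) ∘ u X A ∘ k
      ≈⟨ ∘-resp-≈ʳ (pullˡ (mm-unit (e †))) ⟩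
        a ∘ u A A ∘ k
      ≈⟨ Equiv.trans (pullˡ a-unit) identityˡ ⟩
        k
      ∎

    id#u-†≈a : (id #₁ u A A) † ≈ a
    id#u-†≈a = begin
        (id #₁ u A A) †
      ≈⟨ solution (id #₁ u A A) ⟩
        a ∘ (id #₁ (id #₁ u A A) †) ∘ (id #₁ u A A)
      ≈⟨ ∘-resp-≈ʳ (Equiv.trans id#-compose (#-resp-≈ Equiv.refl †∘u)) ⟩
        a ∘ (id #₁ id)
      ≈⟨ Equiv.trans (∘-resp-≈ʳ #-identity) identityʳ ⟩
        a
      ∎
      where
      †∘u : (id #₁ u A A) † ∘ u A A ≈ id
      †∘u = †∘-unit (id #₁ u A A) (u A A) id (Equiv.trans (mm-unit (u A A)) (Equiv.sym identityʳ))

    -- [ id , d ] maps the combined system c ■ e onto c, so functoriality identifies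
    -- c † ∘ d with a solution of c ■ e, and compositionality computes that solution.
    †∘-solution : (c : A ⇒ (A # A)) → c ∘ a ≈ m A A ∘ (c #₁ id) →
                  ∀ {X} (e : X ⇒ (A # X)) (d : X ⇒ A) → d ≈ a ∘ (id #₁ d) ∘ e →
                  c † ∘ d ≈ (c † • e) †
    †∘-solution c c-hom {X} e d d-sol = begin
        c † ∘ d
      ≈⟨ ∘-resp-≈ʳ inject₂ ⟨
        c † ∘ [ id , d ] ∘ inr
      ≈⟨ pullˡ (functoriality (c ■ e) c [ id , d ] lifted) ⟩
        (c ■ e) † ∘ inr
      ≈⟨ compositionality c e ⟩
        (c † • e) †
      ∎
      where
      lifted : c ∘ [ id , d ] ≈ (id #₁ [ id , d ]) ∘ (c ■ e)
      lifted = coproduct-ext on-inl on-inr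
        where
        id#[id,d]∘inl : (id #₁ ([ id , d ] ∘ inl)) ∘ c ≈ c
        id#[id,d]∘inl = Equiv.trans (∘-resp-≈ˡ (#-resp-≈ Equiv.refl inject₁)) #-identityˡ
        on-inl : (c ∘ [ id , d ]) ∘ inl ≈ ((id #₁ [ id , d ]) ∘ (c ■ e)) ∘ inl
        on-inl = begin
            (c ∘ [ id , d ]) ∘ inl
          ≈⟨ Equiv.trans assoc (Equiv.trans (∘-resp-≈ʳ inject₁) identityʳ) ⟩
            c
          ≈⟨ id#[id,d]∘inl ⟨
            (id #₁ ([ id , d ] ∘ inl)) ∘ c
          ≈⟨ pullˡ id#-compose ⟨
            (id #₁ [ id , d ]) ∘ (id #₁ inl) ∘ c
          ≈⟨ Equiv.trans assoc (∘-resp-≈ʳ (■∘inl c e)) ⟨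
            ((id #₁ [ id , d ]) ∘ (c ■ e)) ∘ inl
          ∎
        on-inr : (c ∘ [ id , d ]) ∘ inr ≈ ((id #₁ [ id , d ]) ∘ (c ■ e)) ∘ inr
        on-inr = begin
            (c ∘ [ id , d ]) ∘ inr
          ≈⟨ Equiv.trans assoc (∘-resp-≈ʳ (Equiv.trans inject₂ d-sol)) ⟩
            c ∘ a ∘ (id #₁ d) ∘ e
          ≈⟨ Equiv.trans (pullˡ c-hom) assoc ⟩
            m A A ∘ (c #₁ id) ∘ (id #₁ d) ∘ e
          ≈⟨ ∘-resp-≈ʳ (pullˡ (Equiv.trans #-compose (#-resp-≈ identityʳ identityˡ))) ⟩
            m A A ∘ (c #₁ d) ∘ e
          ≈⟨ ∘-resp-≈ʳ (∘-resp-≈ˡ (#-resp-≈ id#[id,d]∘inl inject₂)) ⟨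
            m A A ∘ (((id #₁ ([ id , d ] ∘ inl)) ∘ c) #₁ ([ id , d ] ∘ inr)) ∘ e
          ≈⟨ Equiv.trans assoc (id#∘■∘inr [ id , d ] c e) ⟨
            ((id #₁ [ id , d ]) ∘ (c ■ e)) ∘ inr
          ∎

  id-isElgotMorphism : (𝔸 : CompleteElgotAlgebra CP P) →
                       IsElgotMorphism CP P 𝔸 𝔸 id
  id-isElgotMorphism 𝔸 e = Equiv.trans (†-resp-≈ #-identityˡ) (Equiv.sym identityˡ)
    where open ElgotAlgebraProperties 𝔸

  ∘-isElgotMorphism : {𝔸 𝔹 ℂ : CompleteElgotAlgebra CP P}
    {g : CompleteElgotAlgebra.A 𝔹 ⇒ CompleteElgotAlgebra.A ℂ}
    {f : CompleteElgotAlgebra.A 𝔸 ⇒ CompleteElgotAlgebra.A 𝔹} →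
    IsElgotMorphism CP P 𝔹 ℂ g → IsElgotMorphism CP P 𝔸 𝔹 f → IsElgotMorphism CP P 𝔸 ℂ (g ∘ f)
  ∘-isElgotMorphism {𝔸} {𝔹} {ℂ} {g} {f} g-elgot f-elgot e = begin
      ((g ∘ f) • e) †ᶜ
    ≈⟨ †-resp-≈ •-∘ ⟨
      (g • f • e) †ᶜ
    ≈⟨ g-elgot (f • e) ⟩
      g ∘ (f • e) †ᵇ
    ≈⟨ ∘-resp-≈ʳ (f-elgot e) ⟩
      g ∘ f ∘ e †ᵃ
    ≈⟨ assoc ⟨
      (g ∘ f) ∘ e †ᵃ
    ∎
    where
    open CompleteElgotAlgebra 𝔸 using () renaming (_† to _†ᵃ)
    open CompleteElgotAlgebra 𝔹 using () renaming (_† to _†ᵇ)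
    open CompleteElgotAlgebra ℂ using () renaming (_† to _†ᶜ)
    open ElgotAlgebraProperties ℂ using (†-resp-≈)

  module SquareAlgebra (𝔸 : CompleteElgotAlgebra CP P) where
    open CompleteElgotAlgebra 𝔸
    open ElgotAlgebraProperties 𝔸

    square-a : ((A # A) # (A # A)) ⇒ (A # A)
    square-a = m A A ∘ (id #₁ a)

    -- Solve the flattened system a • e in 𝔸, then substitute the solution into e.
    _‡ : ∀ {Z} → Z ⇒ ((A # A) # Z) → Z ⇒ (A # A)
    e ‡ = m A A ∘ (id #₁ (a • e) †) ∘ e

    a∘‡ : ∀ {Z} (e : Z ⇒ ((A # A) # Z)) → a ∘ e ‡ ≈ (a • e) †
    a∘‡ e = begin
        a ∘ m A A ∘ (id #₁ (a • e) †) ∘ e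
      ≈⟨ Equiv.trans (pullˡ (Equiv.sym a-mult)) assoc ⟩
        a ∘ (a #₁ id) ∘ (id #₁ (a • e) †) ∘ e
      ≈⟨ ∘-resp-≈ʳ (Equiv.trans (pullˡ #-commute) assoc) ⟩
        a ∘ (id #₁ (a • e) †) ∘ a • e
      ≈⟨ solution (a • e) ⟨
        (a • e) †
      ∎

    square-a-unit : square-a ∘ u (A # A) (A # A) ≈ id
    square-a-unit = Equiv.trans assoc (Equiv.trans (∘-resp-≈ʳ (mm-unit a)) m-identityˡ)

    square-a-mult : square-a ∘ (square-a #₁ id) ≈ square-a ∘ m (A # A) (A # A)
    square-a-mult = begin
        (m A A ∘ (id #₁ a)) ∘ (square-a #₁ id)
      ≈⟨ Equiv.trans assoc (∘-resp-≈ʳ interchange) ⟩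
        m A A ∘ (m A A #₁ id) ∘ ((id #₁ a) #₁ a)
      ≈⟨ Equiv.trans (pullˡ (Equiv.sym m-assoc)) assoc ⟩
        m A A ∘ m A (A # A) ∘ ((id #₁ a) #₁ a)
      ≈⟨ ∘-resp-≈ʳ (mm-mult a) ⟨
        m A A ∘ (id #₁ a) ∘ m (A # A) (A # A)
      ≈⟨ assoc ⟨
        square-a ∘ m (A # A) (A # A)
      ∎
      where
      interchange : (id #₁ a) ∘ (square-a #₁ id) ≈ (m A A #₁ id) ∘ ((id #₁ a) #₁ a)
      interchange = Equiv.trans #-compose (Equiv.trans (#-resp-≈ identityˡ identityʳ)
        (Equiv.trans (#-resp-≈ Equiv.refl (Equiv.sym identityˡ)) #-homomorphism))

    ‡-solution : ∀ {Z} (e : Z ⇒ ((A # A) # Z)) → e ‡ ≈ square-a ∘ (id #₁ e ‡) ∘ e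
    ‡-solution e = begin
        m A A ∘ (id #₁ (a • e) †) ∘ e
      ≈⟨ ∘-resp-≈ʳ (∘-resp-≈ˡ (#-resp-≈ Equiv.refl (a∘‡ e))) ⟨
        m A A ∘ (id #₁ (a ∘ e ‡)) ∘ e
      ≈⟨ ∘-resp-≈ʳ (pullˡ id#-compose) ⟨
        m A A ∘ (id #₁ a) ∘ (id #₁ e ‡) ∘ e
      ≈⟨ assoc ⟨
        square-a ∘ (id #₁ e ‡) ∘ e
      ∎

    ‡-functoriality : ∀ {X Z} (e : X ⇒ ((A # A) # X)) (f : Z ⇒ ((A # A) # Z)) (h : X ⇒ Z) →
                      f ∘ h ≈ (id #₁ h) ∘ e → f ‡ ∘ h ≈ e ‡
    ‡-functoriality e f h f∘h = begin
        (m A A ∘ (id #₁ (a • f) †) ∘ f) ∘ h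
      ≈⟨ Equiv.trans assoc (∘-resp-≈ʳ (Equiv.trans assoc (∘-resp-≈ʳ f∘h))) ⟩
        m A A ∘ (id #₁ (a • f) †) ∘ (id #₁ h) ∘ e
      ≈⟨ ∘-resp-≈ʳ (pullˡ id#-compose) ⟩
        m A A ∘ (id #₁ ((a • f) † ∘ h)) ∘ e
      ≈⟨ ∘-resp-≈ʳ (∘-resp-≈ˡ (#-resp-≈ Equiv.refl (functoriality (a • e) (a • f) h a•f∘h))) ⟩
        m A A ∘ (id #₁ (a • e) †) ∘ e
      ∎
      where
      a•f∘h : (a • f) ∘ h ≈ (id #₁ h) ∘ a • e
      a•f∘h = begin
          (a • f) ∘ h
        ≈⟨ Equiv.trans assoc (∘-resp-≈ʳ f∘h) ⟩
          (a #₁ id) ∘ (id #₁ h) ∘ e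
        ≈⟨ Equiv.trans (pullˡ #-commute) assoc ⟩
          (id #₁ h) ∘ a • e
        ∎

    ‡-compositionality : ∀ {X Y} (f : Y ⇒ ((A # A) # Y)) (g : X ⇒ (Y # X)) →
                         (f ■ g) ‡ ∘ inr ≈ (f ‡ • g) ‡
    ‡-compositionality {X} {Y} f g = Equiv.trans ■-side (Equiv.sym •-side)
      where
      K : (Y + X) ⇒ A
      K = ((a • f) ■ g) †
      K∘inl : K ∘ inl ≈ (a • f) †
      K∘inl = functoriality (a • f) ((a • f) ■ g) inl (■∘inl (a • f) g)
      common-value : X ⇒ (A # A)
      common-value = m A A ∘ m A (A # A) ∘ (((id #₁ (a • f) †) ∘ f) #₁ (K ∘ inr)) ∘ g
      ■-side : (f ■ g) ‡ ∘ inr ≈ common-value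
      ■-side = begin
          (m A A ∘ (id #₁ (a • (f ■ g)) †) ∘ (f ■ g)) ∘ inr
        ≈⟨ Equiv.trans assoc (∘-resp-≈ʳ assoc) ⟩
          m A A ∘ (id #₁ (a • (f ■ g)) †) ∘ (f ■ g) ∘ inr
        ≈⟨ ∘-resp-≈ʳ (∘-resp-≈ˡ (#-resp-≈ Equiv.refl (†-resp-≈ (•-■ a f g)))) ⟩
          m A A ∘ (id #₁ K) ∘ (f ■ g) ∘ inr
        ≈⟨ ∘-resp-≈ʳ (id#∘■∘inr K f g) ⟩
          m A A ∘ m A (A # A) ∘ (((id #₁ (K ∘ inl)) ∘ f) #₁ (K ∘ inr)) ∘ g
        ≈⟨ ∘-resp-≈ʳ (∘-resp-≈ʳ (∘-resp-≈ˡ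
             (#-resp-≈ (∘-resp-≈ˡ (#-resp-≈ Equiv.refl K∘inl)) Equiv.refl))) ⟩
          m A A ∘ m A (A # A) ∘ (((id #₁ (a • f) †) ∘ f) #₁ (K ∘ inr)) ∘ g
        ∎
      •-side : (f ‡ • g) ‡ ≈ common-value
      •-side = begin
          m A A ∘ (id #₁ (a • f ‡ • g) †) ∘ (f ‡ #₁ id) ∘ g
        ≈⟨ ∘-resp-≈ʳ (∘-resp-≈ˡ (#-resp-≈ Equiv.refl a•f‡•g†)) ⟩
          m A A ∘ (id #₁ (K ∘ inr)) ∘ (f ‡ #₁ id) ∘ g
        ≈⟨ ∘-resp-≈ʳ (pullˡ (Equiv.trans #-compose (#-resp-≈ identityˡ identityʳ))) ⟩
          m A A ∘ (f ‡ #₁ (K ∘ inr)) ∘ g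
        ≈⟨ ∘-resp-≈ʳ (Equiv.trans (∘-resp-≈ˡ (Equiv.trans (#-resp-≈ Equiv.refl (Equiv.sym identityˡ))
                                                             #-homomorphism)) assoc) ⟩
          m A A ∘ (m A A #₁ id) ∘ (((id #₁ (a • f) †) ∘ f) #₁ (K ∘ inr)) ∘ g
        ≈⟨ Equiv.trans (pullˡ (Equiv.sym m-assoc)) assoc ⟩
          m A A ∘ m A (A # A) ∘ (((id #₁ (a • f) †) ∘ f) #₁ (K ∘ inr)) ∘ g
        ∎
        where
        a•f‡•g† : (a • f ‡ • g) † ≈ K ∘ inr
        a•f‡•g† = Equiv.trans
          (†-resp-≈ (Equiv.trans •-∘ (∘-resp-≈ˡ (#-resp-≈ (a∘‡ f) Equiv.refl))))
                              (Equiv.sym (compositionality (a • f) g))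

    square : CompleteElgotAlgebra CP P
    square = record
      { A = A # A ; a = square-a ; a-unit = square-a-unit ; a-mult = square-a-mult
      ; _† = _‡ ; solution = ‡-solution ; functoriality = ‡-functoriality
      ; compositionality = ‡-compositionality }

    a-isElgotMorphism : IsElgotMorphism CP P square 𝔸 a
    a-isElgotMorphism e = Equiv.sym (a∘‡ e)

    open ElgotAlgebraProperties square using () renaming (†∘-unit to ‡∘-unit)

    section-homomorphic : (c : A ⇒ (A # A)) → IsElgotMorphism CP P 𝔸 square c → a ∘ c ≈ id →
                          c ∘ a ≈ m A A ∘ (c #₁ id)
    section-homomorphic c c-elgot a∘c = begin
        c ∘ a
      ≈⟨ ∘-resp-≈ʳ id#u-†≈a ⟨
        c ∘ (id #₁ u A A) †
      ≈⟨ c-elgot (id #₁ u A A) ⟨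
        G ‡
      ≈⟨ ‡-solution G ⟩
        square-a ∘ (id #₁ G ‡) ∘ (c #₁ id) ∘ (id #₁ u A A)
      ≈⟨ ∘-resp-≈ʳ (∘-resp-≈ʳ (Equiv.trans #-compose (#-resp-≈ identityʳ identityˡ))) ⟩
        square-a ∘ (id #₁ G ‡) ∘ (c #₁ u A A)
      ≈⟨ ∘-resp-≈ʳ (Equiv.trans #-compose (#-resp-≈ identityˡ G‡∘u)) ⟩
        square-a ∘ (c #₁ c)
      ≈⟨ Equiv.trans assoc (∘-resp-≈ʳ (Equiv.trans #-compose (#-resp-≈ identityˡ a∘c))) ⟩
        m A A ∘ (c #₁ id)
      ∎
      where
      G : (A # A) ⇒ ((A # A) # (A # A))
      G = (c #₁ id) ∘ (id #₁ u A A)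
      G∘u : G ∘ u A A ≈ u (A # A) (A # A) ∘ c
      G∘u = Equiv.trans assoc (Equiv.trans (∘-resp-≈ʳ (mm-unit (u A A))) (u-natural c))
      G‡∘u : G ‡ ∘ u A A ≈ c
      G‡∘u = ‡∘-unit G (u A A) c G∘u

  module FreeElgotAlgebra (Y : Obj) (FY : CompleteElgotAlgebra CP P)
                          (η : Y ⇒ CompleteElgotAlgebra.A FY) (free : IsFreeElgot CP P Y FY η) where
    open CompleteElgotAlgebra FY
    open ElgotAlgebraProperties FY
    open SquareAlgebra FY

    endomorphism-unique : (h : A ⇒ A) → IsElgotMorphism CP P FY FY h → h ∘ η ≈ η → h ≈ id
    endomorphism-unique h h-elgot h∘η =
      Equiv.trans (unique h h-elgot h∘η) (Equiv.sym (unique id (id-isElgotMorphism FY) identityˡ))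
      where unique = proj₂ (proj₂ (free FY η))

    embedding : A ⇒ (A # A)
    embedding = proj₁ (free square (u A A ∘ η))

    embedding-isElgotMorphism : IsElgotMorphism CP P FY square embedding
    embedding-isElgotMorphism = proj₁ (proj₁ (proj₂ (free square (u A A ∘ η))))

    embedding∘η : embedding ∘ η ≈ u A A ∘ η
    embedding∘η = proj₂ (proj₁ (proj₂ (free square (u A A ∘ η))))

    a∘embedding : a ∘ embedding ≈ id
    a∘embedding = endomorphism-unique (a ∘ embedding)
      (∘-isElgotMorphism {FY} {square} {FY} a-isElgotMorphism embedding-isElgotMorphism)
      (Equiv.trans assoc (Equiv.trans (∘-resp-≈ʳ embedding∘η) (Equiv.trans (pullˡ a-unit) identityˡ)))

    embedding-homomorphic : embedding ∘ a ≈ m A A ∘ (embedding #₁ id)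
    embedding-homomorphic = section-homomorphic embedding embedding-isElgotMorphism a∘embedding

    embedding†≈id : embedding † ≈ id
    embedding†≈id = endomorphism-unique (embedding †) embedding†-isElgotMorphism
      (†∘-unit embedding η η embedding∘η)
      where
      embedding†-isElgotMorphism : IsElgotMorphism CP P FY FY (embedding †)
      embedding†-isElgotMorphism e =
        Equiv.sym (†∘-solution embedding embedding-homomorphic e (e †) (solution e))

proposition4p16 : ∀ {o ℓ e} {C : Category o ℓ e} (CP : FiniteCoproducts C) (P : ParametrizedMonad C)
    (Y : Category.Obj C) (FY : CompleteElgotAlgebra CP P)
    (η : Category._⇒_ C Y (CompleteElgotAlgebra.A FY)) →
    IsFreeElgot CP P Y FY η →
    ∀ {X : Category.Obj C}
    (e : Category._⇒_ C X (ParametrizedMonad._#_ P (CompleteElgotAlgebra.A FY) X)) →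
    UniqueSolution CP P FY e
proposition4p16 {C = C} CP P Y FY η free e = solution e , λ d d-sol → begin
    d
  ≈⟨ Equiv.trans (∘-resp-≈ˡ embedding†≈id) identityˡ ⟨
    embedding † ∘ d
  ≈⟨ †∘-solution embedding embedding-homomorphic e d d-sol ⟩
    (embedding † • e) †
  ≈⟨ †-resp-≈ (Equiv.trans (∘-resp-≈ˡ (#-resp-≈ embedding†≈id Equiv.refl)) #-identityˡ) ⟩
    e †
  ∎
  where
  open Category C
  open ParametrizedMonad P
  open CompleteElgotAlgebra FY
  open ElgotAlgebraTheory CP P
  open HomReasoning using (begin_; _∎; step-≈-⟩; step-≈-⟨)
  open ElgotAlgebraProperties FY
  open FreeElgotAlgebra Y FY η free
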